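{- Let $C_n=((v_0,\dots,v_{n-1}),c)$ be an edge-colored oriented cycle of order $n$. Suppose there exist $i,j\in[n]$ with $i\neq j$ such that for every $s\in[n]$ at least one of the following holds (which one may depend on $s$): either $c(e_{i+s-1})=c(e_{j+s-1})$ and $c(e_{i+s})=c(e_{j+s})$, or $c(e_{i+s-1})=\overline{c(e_{j+s})}$ and $c(e_{i+s})=\overline{c(e_{j+s-1})}$. Then one of the following holds: (1) $\varphi(v_x)=v_{x+j-i}$, $x\in[n]$, defines a color respecting automorphism of $C_n$; or (2) $\varphi(v_x)=v_{x+2}$, $x\in[n]$, defines a color respecting automorphism of $C_n$, and in this case $c(e)_1=0$ for every edge $e$ of $C_n$.
   Context: All indices are modulo $n$. For distinct vertices $v_0,\dots,v_{n-1}$, let $e_i=\{v_i,v_{i+1}\}$ and $E=\{e_i:i\in[n]\}$. Given a set $A$ of colors and a map $c:E\to\mathbb F_3\times A$, the pair $C_n=((v_0,\dots,v_{n-1}),c)$ is an edge-colored oriented cycle; $c(e)$ is the directed color of $e$, $c(e)_1\in\mathbb F_3$ its orientation, $c(e)_2$ its undirected color, and $\overline{c(e)}=(-c(e)_1,c(e)_2)$. A bijection $\varphi$ of $\{v_0,\dots,v_{n-1}\}$ is a color respecting automorphism if for every $i\in[n]$ there is $j\in[n]$ with $\{\varphi(v_i),\varphi(v_{i+1})\}=\{v_j,v_{j+1}\}$ and $c(\{\varphi(v_i),\varphi(v_{i+1})\})$ equals $c(\{v_j,v_{j+1}\})$ if $(\varphi(v_i),\varphi(v_{i+1}))=(v_j,v_{j+1})$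 and equals $\overline{c(\{v_j,v_{j+1}\})}$ if $(\varphi(v_i),\varphi(v_{i+1}))=(v_{j+1},v_j)$. -}

module Defs where

open import Data.Nat using (ℕ; zero; suc; _+_; _∸_; _%_; NonZero)
open import Data.Nat.DivMod using (m%n<n)
open import Data.Fin using (Fin; toℕ; fromℕ<)
open import Data.Product using (_×_; _,_; ∃-syntax; proj₁; proj₂)
open import Data.Sum using (_⊎_)
open import Relation.Binary.PropositionalEquality using (_≡_)
open import Function.Definitions using (Bijective)

𝔽₃ : Set
𝔽₃ = Fin 3

neg₃ : 𝔽₃ → 𝔽₃
neg₃ Fin.zero = Fin.zero
neg₃ (Fin.suc Fin.zero) = Fin.suc (Fin.suc Fin.zero)
neg₃ (Fin.suc (Fin.suc Fin.zero)) = Fin.suc Fin.zero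

DColor : Set → Set
DColor A = 𝔽₃ × A

bar : {A : Set} → DColor A → DColor A
bar (o , a) = (neg₃ o , a)

modF : (n : ℕ) → .{{_ : NonZero n}} → ℕ → Fin n
modF n k = fromℕ< (m%n<n k n)

-- An edge-colored oriented cycle of order n: vertices v_0..v_{n-1} are
-- identified with Fin n (v_x ↦ x), edge e_k = {v_k, v_{k+1}}, and the
-- colouring is c : Fin n → DColor A, c k being the colour of e_k.
-- Index arithmetic is modulo n.

col : {A : Set} (n : ℕ) → .{{_ : NonZero n}} → (Fin n → DColor A) → ℕ → DColor A
col n c k = c (modF n k)

next : (n : ℕ) → .{{_ : NonZero n}} → Fin n → Fin n
next n x = modF n (suc (toℕ x))

IsColorRespectingAut : {A : Set} (n : ℕ) → .{{_ : NonZero n}} →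
  (Fin n → DColor A) → (Fin n → Fin n) → Set
IsColorRespectingAut n c φ =
  Bijective _≡_ _≡_ φ ×
  ((i : Fin n) → ∃[ j ]
     ((φ i ≡ j × φ (next n i) ≡ next n j × c i ≡ c j)
      ⊎ (φ i ≡ next n j × φ (next n i) ≡ j × c i ≡ bar (c j))))

shift : (n : ℕ) → .{{_ : NonZero n}} → ℕ → Fin n → Fin n
shift n d x = modF n (toℕ x + d)

-- Put d = j − i and f(x) = c(e_x).  The hypothesis says that around every
-- position x the pair of edges (e_x, e_{x+1}) is either translated by d
-- (f x = f (x+d) and f (x+1) = f (x+1+d)) or reflected (f x = bar f (x+1+d)
-- and f (x+1) = bar f (x+d)).  In both cases f (x+1) = f (x+1+d) forces
-- f x = f (x+d), so a single translated position propagates backwards around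
-- the whole cycle, and rotation by d is an automorphism.  Otherwise every
-- position is reflected; then f x = bar f (x+1+d) = f (x+2), so rotation by 2
-- is an automorphism, and either d is even (rotation by d is one as well) or
-- d is odd and f x = bar f x, i.e. every orientation is 0.
module Submission where

open import Defs
open import Data.Nat using (ℕ; zero; suc; _+_; _*_; _∸_; _%_; _<_; _≤_; s≤s; NonZero)
open import Data.Nat.Properties using (+-assoc; +-comm; +-suc; suc-pred; m+[n∸m]≡n; <⇒≤; m≤n⇒m<n∨m≡n)
open import Data.Nat.DivMod using (%-distribˡ-+; [m+n]%n≡m%n; [m+kn]%n≡m%n; m%n%n≡m%n; m<n⇒m%n≡m; m%n<n; m%n≤n)
open import Data.Nat.Tactic.RingSolver using (solve-∀)
open import Data.Fin using (Fin; toℕ; zero)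
open import Data.Fin.Properties using (toℕ-fromℕ<; toℕ<n; fromℕ<-cong; fromℕ<-toℕ)
open import Data.Product using (_×_; _,_; ∃; ∃-syntax; proj₁; proj₂)
open import Data.Sum using (_⊎_; inj₁; inj₂; map; map₁)
open import Function.Bundles using (Bijection; mk↔ₛ′)
open import Function.Definitions using (Bijective)
open import Function.Properties.Inverse using (↔⇒⤖)
open import Level using (0ℓ)
open import Relation.Binary.Bundles using (Setoid)
open import Relation.Binary.PropositionalEquality using (_≡_; _≢_; refl; sym; trans; cong; cong₂; subst₂; module ≡-Reasoning)
import Relation.Binary.Reasoning.Setoid as SetoidReasoning

bar-involutive : {A : Set} (x : DColor A) → bar (bar x) ≡ x
bar-involutive (Fin.zero , _) = refl
bar-involutive (Fin.suc Fin.zero , _) = refl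
bar-involutive (Fin.suc (Fin.suc Fin.zero) , _) = refl

bar-fixed⇒unoriented : {A : Set} (x : DColor A) → x ≡ bar x → proj₁ x ≡ zero
bar-fixed⇒unoriented (Fin.zero , _) _ = refl
bar-fixed⇒unoriented (Fin.suc Fin.zero , _) ()
bar-fixed⇒unoriented (Fin.suc (Fin.suc Fin.zero) , _) ()

even-or-odd : ∀ d → ∃[ k ] (d ≡ k * 2 ⊎ d ≡ 1 + k * 2)
even-or-odd zero = 0 , inj₁ refl
even-or-odd (suc d) with even-or-odd d
... | k , inj₁ refl = k , inj₂ refl
... | k , inj₂ refl = suc k , inj₁ refl

∃-or-∀< : {P Q : ℕ → Set} → (∀ x → P x ⊎ Q x) → ∀ k → ∃ P ⊎ (∀ {x} → x < k → Q x)
∃-or-∀< H zero = inj₂ λ ()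
∃-or-∀< {Q = Q} H (suc k) with ∃-or-∀< H k | H k
... | inj₁ p | _ = inj₁ p
... | inj₂ _ | inj₁ p = inj₁ (k , p)
... | inj₂ below | inj₂ q = inj₂ below-suc
  where
  below-suc : ∀ {x} → x < suc k → Q x
  below-suc (s≤s x≤k) with m≤n⇒m<n∨m≡n x≤k
  ... | inj₁ x<k = below x<k
  ... | inj₂ refl = q

multiple-period : {X : Set} (f : ℕ → X) (p : ℕ) → (∀ x → f x ≡ f (p + x)) →
  ∀ k x → f x ≡ f (k * p + x)
multiple-period f p period zero x = refl
multiple-period f p period (suc k) x =
  trans (multiple-period f p period k x)
        (trans (period (k * p + x)) (cong f (sym (+-assoc p (k * p) x))))

module Modulo (n : ℕ) .{{_ : NonZero n}} where

  infix 4 _≈_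
  record _≈_ (a b : ℕ) : Set where
    constructor mk
    field %-≡ : a % n ≡ b % n

  ≈-setoid : Setoid 0ℓ 0ℓ
  ≈-setoid = record
    { Carrier = ℕ
    ; _≈_ = _≈_
    ; isEquivalence = record
      { refl = mk refl
      ; sym = λ (mk p) → mk (sym p)
      ; trans = λ (mk p) (mk q) → mk (trans p q)
      }
    }

  open Setoid ≈-setoid public using () renaming (refl to ≈-refl; sym to ≈-sym; trans to ≈-trans)

  +-cong : ∀ {a a′ b b′} → a ≈ a′ → b ≈ b′ → a + b ≈ a′ + b′
  +-cong {a} {a′} {b} {b′} (mk p) (mk q) = mk (trans (%-distribˡ-+ a b n)
    (trans (cong₂ (λ u v → (u + v) % n) p q) (sym (%-distribˡ-+ a′ b′ n))))

  +-periodic : ∀ a k → a + k * n ≈ a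
  +-periodic a k = mk ([m+kn]%n≡m%n a k n)

  +n≈ : ∀ a → a + n ≈ a
  +n≈ a = mk ([m+n]%n≡m%n a n)

  toℕ-modF : ∀ a → toℕ (modF n a) ≈ a
  toℕ-modF a = mk (trans (cong (_% n) (toℕ-fromℕ< (m%n<n a n))) (m%n%n≡m%n a n))

  modF-cong : ∀ {a b} → a ≈ b → modF n a ≡ modF n b
  modF-cong (mk p) = fromℕ<-cong _ _ p _ _

  modF-toℕ : (x : Fin n) → modF n (toℕ x) ≡ x
  modF-toℕ x = trans (fromℕ<-cong _ _ (m<n⇒m%n≡m (toℕ<n x)) _ (toℕ<n x)) (fromℕ<-toℕ x (toℕ<n x))

  open SetoidReasoning ≈-setoid

  shift-next : ∀ e x → shift n e (next n x) ≡ next n (shift n e x)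
  shift-next e x = modF-cong (begin
    toℕ (modF n (suc (toℕ x))) + e ≈⟨ +-cong (toℕ-modF (suc (toℕ x))) ≈-refl ⟩
    suc (toℕ x + e)                ≈⟨ +-cong {1} ≈-refl (toℕ-modF (toℕ x + e)) ⟨
    suc (toℕ (modF n (toℕ x + e))) ∎)

  shift-shift : ∀ a b x → shift n a (shift n b x) ≡ shift n (b + a) x
  shift-shift a b x = modF-cong (begin
    toℕ (modF n (toℕ x + b)) + a ≈⟨ +-cong (toℕ-modF (toℕ x + b)) ≈-refl ⟩
    toℕ x + b + a               ≡⟨ +-assoc (toℕ x) b a ⟩
    toℕ x + (b + a)             ∎)

  shift-≈0 : ∀ {a} → a ≈ 0 → ∀ x → shift n a x ≡ x
  shift-≈0 {a} a≈0 x = trans (modF-cong (begin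
    toℕ x + a ≈⟨ +-cong ≈-refl a≈0 ⟩
    toℕ x + 0 ≡⟨ +-comm (toℕ x) 0 ⟩
    toℕ x     ∎)) (modF-toℕ x)

  shift-bijective : ∀ e → Bijective _≡_ _≡_ (shift n e)
  shift-bijective e = Bijection.bijective (↔⇒⤖ (mk↔ₛ′ (shift n e) (shift n e′)
    (λ x → trans (shift-shift e e′ x) (shift-≈0 (≈-trans (≈-sym (+-comm′ e e′)) e+e′≈0) x))
    (λ x → trans (shift-shift e′ e x) (shift-≈0 e+e′≈0 x))))
    where
    e′ : ℕ
    e′ = n ∸ e % n
    +-comm′ : ∀ a b → a + b ≈ b + a
    +-comm′ a b = mk (cong (_% n) (+-comm a b))
    e+e′≈0 : e + e′ ≈ 0
    e+e′≈0 = begin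
      e + e′       ≈⟨ +-cong (mk (sym (m%n%n≡m%n e n))) ≈-refl ⟩
      e % n + e′   ≡⟨ m+[n∸m]≡n (m%n≤n e n) ⟩
      n            ≈⟨ +n≈ 0 ⟩
      0            ∎

module Cycle {A : Set} (n : ℕ) .{{_ : NonZero n}} (c : Fin n → DColor A) where

  open Modulo n

  f : ℕ → DColor A
  f = col n c

  col-cong : ∀ {a b} → a ≈ b → f a ≡ f b
  col-cong a≈b = cong c (modF-cong a≈b)

  col-toℕ : ∀ x → f (toℕ x) ≡ c x
  col-toℕ x = cong c (modF-toℕ x)

  shift-isColorRespectingAut : ∀ e → (∀ x → f x ≡ f (x + e)) → IsColorRespectingAut n c (shift n e)
  shift-isColorRespectingAut e invariant = shift-bijective e ,
    λ x → shift n e x , inj₁ (refl , shift-next e x , trans (sym (col-toℕ x)) (invariant (toℕ x)))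

  module Symmetry (d : ℕ) where

    Agrees : ℕ → Set
    Agrees x = f x ≡ f (x + d)

    Mirrors : ℕ → Set
    Mirrors x = f x ≡ bar (f (suc x + d)) × f (suc x) ≡ bar (f (x + d))

    LocalSymmetry : ℕ → Set
    LocalSymmetry x = (Agrees x × Agrees (suc x)) ⊎ Mirrors x

    agrees-pred : ∀ {x} → LocalSymmetry x → Agrees (suc x) → Agrees x
    agrees-pred (inj₁ (agrees , _)) _ = agrees
    agrees-pred {x} (inj₂ (mirror , mirror′)) agrees-suc = begin
      f x                       ≡⟨ mirror ⟩
      bar (f (suc x + d))       ≡⟨ cong bar agrees-suc ⟨
      bar (f (suc x))           ≡⟨ cong bar mirror′ ⟩
      bar (bar (f (x + d)))     ≡⟨ bar-involutive (f (x + d)) ⟩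
      f (x + d)                 ∎
      where open ≡-Reasoning

    agrees-cong : ∀ {a b} → a ≈ b → Agrees a → Agrees b
    agrees-cong a≈b agrees = trans (sym (col-cong a≈b)) (trans agrees (col-cong (+-cong a≈b ≈-refl)))

    mirrors-cong : ∀ {a b} → a ≈ b → Mirrors a → Mirrors b
    mirrors-cong a≈b (mirror , mirror′) =
      subst₂ (λ u v → u ≡ bar v) (col-cong a≈b) (col-cong (+-cong (+-cong {1} ≈-refl a≈b) ≈-refl)) mirror ,
      subst₂ (λ u v → u ≡ bar v) (col-cong (+-cong {1} ≈-refl a≈b)) (col-cong (+-cong a≈b ≈-refl)) mirror′

    module _ (symmetric : ∀ x → LocalSymmetry x) where

      agrees-+ : ∀ k x → Agrees (k + x) → Agrees x
      agrees-+ zero x agrees = agrees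
      agrees-+ (suc k) x agrees = agrees-+ k x (agrees-pred (symmetric (k + x)) agrees)

      -- Going back b + x·(n − 1) steps from b lands on x, since that sum is b + x·n.
      agrees-everywhere : ∀ {b} → Agrees b → ∀ x → Agrees x
      agrees-everywhere {b} agrees x =
        agrees-+ (b + x * (n ∸ 1)) x (agrees-cong (≈-sym lands-on-b) agrees)
        where
        open SetoidReasoning ≈-setoid
        rearrange : ∀ b x m → b + x * m + x ≡ b + x * suc m
        rearrange = solve-∀
        lands-on-b : b + x * (n ∸ 1) + x ≈ b
        lands-on-b = begin
          b + x * (n ∸ 1) + x     ≡⟨ rearrange b x (n ∸ 1) ⟩
          b + x * suc (n ∸ 1)     ≡⟨ cong (λ m → b + x * m) (suc-pred n) ⟩
          b + x * n               ≈⟨ +-periodic b x ⟩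
          b                       ∎

      agrees-or-mirrors : ∃ Agrees ⊎ (∀ x → Mirrors x)
      agrees-or-mirrors with ∃-or-∀< (λ x → map₁ proj₁ (symmetric x)) n
      ... | inj₁ agrees = inj₁ agrees
      ... | inj₂ mirrors = inj₂ λ x → mirrors-cong (mk (m%n%n≡m%n x n)) (mirrors (m%n<n x n))

    mirrors⇒period-2 : (∀ x → Mirrors x) → ∀ x → f x ≡ f (2 + x)
    mirrors⇒period-2 mirrors x = trans (proj₁ (mirrors x)) (sym (proj₂ (mirrors (suc x))))

    mirrors⇒rotation-or-unoriented : (∀ x → Mirrors x) →
      IsColorRespectingAut n c (shift n d)
      ⊎ (IsColorRespectingAut n c (shift n 2) × ((k : Fin n) → proj₁ (c k) ≡ zero))
    mirrors⇒rotation-or-unoriented mirrors with even-or-odd d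
    ... | k , inj₁ refl = inj₁ (shift-isColorRespectingAut d λ x →
          trans (period-2k x) (cong f (+-comm (k * 2) x)))
      where
      period-2k : ∀ x → f x ≡ f (k * 2 + x)
      period-2k = multiple-period f 2 (mirrors⇒period-2 mirrors) k
    ... | k , inj₂ refl = inj₂ (shift-isColorRespectingAut 2 period-2 , unoriented)
      where
      period-2 : ∀ x → f x ≡ f (x + 2)
      period-2 x = trans (mirrors⇒period-2 mirrors x) (cong f (+-comm 2 x))
      self-mirror : ∀ x → f x ≡ bar (f x)
      self-mirror x = trans (proj₁ (mirrors x)) (cong bar (sym (begin
        f x                         ≡⟨ multiple-period f 2 (mirrors⇒period-2 mirrors) (suc k) x ⟩
        f (suc k * 2 + x)           ≡⟨ cong (λ y → f (suc y)) (+-comm (suc (k * 2)) x) ⟩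
        f (suc x + suc (k * 2))     ∎)))
        where open ≡-Reasoning
      unoriented : (y : Fin n) → proj₁ (c y) ≡ zero
      unoriented y = bar-fixed⇒unoriented (c y)
        (subst₂ (λ u v → u ≡ bar v) (col-toℕ y) (col-toℕ y) (self-mirror (toℕ y)))

    rotation-or-unoriented : (∀ x → LocalSymmetry x) →
      IsColorRespectingAut n c (shift n d)
      ⊎ (IsColorRespectingAut n c (shift n 2) × ((k : Fin n) → proj₁ (c k) ≡ zero))
    rotation-or-unoriented symmetric with agrees-or-mirrors symmetric
    ... | inj₁ (_ , agrees) = inj₁ (shift-isColorRespectingAut d (agrees-everywhere symmetric agrees))
    ... | inj₂ mirrors = mirrors⇒rotation-or-unoriented mirrors

module _ {A : Set} (n : ℕ) .{{_ : NonZero n}} (c : Fin n → DColor A) (i j : Fin n) where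

  open Modulo n
  open Cycle n c
  open Symmetry (toℕ j + (n ∸ toℕ i))
  open SetoidReasoning ≈-setoid

  NeighbourhoodsMatch : Set
  NeighbourhoodsMatch = (s : Fin n) →
    ((f (toℕ i + toℕ s + (n ∸ 1)) ≡ f (toℕ j + toℕ s + (n ∸ 1))
      × f (toℕ i + toℕ s) ≡ f (toℕ j + toℕ s))
    ⊎ (f (toℕ i + toℕ s + (n ∸ 1)) ≡ bar (f (toℕ j + toℕ s))
      × f (toℕ i + toℕ s) ≡ bar (f (toℕ j + toℕ s + (n ∸ 1)))))

  -- The hypothesis at s = b + 1 − i speaks about the edges e_b, e_{b+1} and their images under rotation by j − i.
  neighbourhoodsMatch⇒localSymmetry : NeighbourhoodsMatch → ∀ b → LocalSymmetry b
  neighbourhoodsMatch⇒localSymmetry match b = map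
    (λ (agrees , agrees′) →
        subst₂ _≡_ (col-cong (≈-pred at-1+b)) (col-cong (≈-pred at-1+b+d)) agrees
      , subst₂ _≡_ (col-cong at-1+b) (col-cong at-1+b+d) agrees′)
    (λ (mirror , mirror′) →
        subst₂ (λ u v → u ≡ bar v) (col-cong (≈-pred at-1+b)) (col-cong at-1+b+d) mirror
      , subst₂ (λ u v → u ≡ bar v) (col-cong at-1+b) (col-cong (≈-pred at-1+b+d)) mirror′)
    (match s)
    where
    p : ℕ
    p = n ∸ toℕ i
    s : Fin n
    s = modF n (suc b + p)
    at : ∀ a → a + toℕ s ≈ suc b + (a + p)
    at a = begin
      a + toℕ s       ≈⟨ +-cong ≈-refl (toℕ-modF (suc b + p)) ⟩
      a + (suc b + p) ≡⟨ swap a (suc b) p ⟩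
      suc b + (a + p) ∎
      where
      swap : ∀ a b p → a + (b + p) ≡ b + (a + p)
      swap = solve-∀
    at-1+b : toℕ i + toℕ s ≈ suc b
    at-1+b = begin
      toℕ i + toℕ s      ≈⟨ at (toℕ i) ⟩
      suc b + (toℕ i + p) ≡⟨ cong (suc b +_) (m+[n∸m]≡n (<⇒≤ (toℕ<n i))) ⟩
      suc b + n          ≈⟨ +n≈ (suc b) ⟩
      suc b              ∎
    at-1+b+d : toℕ j + toℕ s ≈ suc b + (toℕ j + p)
    at-1+b+d = at (toℕ j)
    ≈-pred : ∀ {a y} → a ≈ suc y → a + (n ∸ 1) ≈ y
    ≈-pred {a} {y} a≈1+y = begin
      a + (n ∸ 1)       ≈⟨ +-cong a≈1+y ≈-refl ⟩
      suc y + (n ∸ 1)   ≡⟨ +-suc y (n ∸ 1) ⟨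
      y + suc (n ∸ 1)   ≡⟨ cong (y +_) (suc-pred n) ⟩
      y + n             ≈⟨ +n≈ y ⟩
      y                 ∎

proposition4p5 : (n : ℕ) → .{{_ : NonZero n}} → 3 ≤ n → (A : Set) → (c : Fin n → DColor A) →
    (i j : Fin n) → i ≢ j →
    ((s : Fin n) →
      ((col n c (toℕ i + toℕ s + (n ∸ 1)) ≡ col n c (toℕ j + toℕ s + (n ∸ 1))
        × col n c (toℕ i + toℕ s) ≡ col n c (toℕ j + toℕ s))
      ⊎ (col n c (toℕ i + toℕ s + (n ∸ 1)) ≡ bar (col n c (toℕ j + toℕ s))
        × col n c (toℕ i + toℕ s) ≡ bar (col n c (toℕ j + toℕ s + (n ∸ 1)))))) →
    IsColorRespectingAut n c (shift n (toℕ j + (n ∸ toℕ i)))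
    ⊎ (IsColorRespectingAut n c (shift n 2) × ((k : Fin n) → proj₁ (c k) ≡ zero))
proposition4p5 n _ A c i j _ match =
  Cycle.Symmetry.rotation-or-unoriented n c (toℕ j + (n ∸ toℕ i))
    (neighbourhoodsMatch⇒localSymmetry n c i j match)
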